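{- Let $y\in{}^\omega(\omega-\{0\})$ be strictly increasing and let $T$ and $T'$ be $y$-squeezed trees. Then $T\cup T'$ is a $y$-squeezed tree.
   Context: For strictly increasing $y$ and $n\in\omega$, $(j,k,m)$ is a $y$-bound system above $n$ iff $k\in\omega$, $j,m:\{0,\dots,k\}\to\omega$, $j(0)>y(n+m(0)+1)$ and $j(l+1)>y(j(l)+m(l+1)+1)$ for $l<k$. A tree $T\subseteq{}^{<\omega}\omega$ (closed under initial segments) is $(j,k,m,\eta)$-squeezed iff $\mathrm{dom}(\eta)=\{(l,t):l\le k,\ t\le m(l)\}$, $\eta(l,t)\in{}^{j(l)}\omega$, and every $\nu\in T$ is comparable with some $\eta(l,t)$. $T$ is $y$-squeezed iff for every $n$ there are a $y$-bound system $(j,k,m)$ above $n$ and $\eta$ such that $T$ is $(j,k,m,\eta)$-squeezed. -}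

module Defs where

open import Data.Nat using (ℕ; zero; suc; _+_; _<_; _>_; NonZero)
open import Data.Fin using (Fin; toℕ; fromℕ<; inject₁) renaming (suc to fsuc; zero to fzero)
open import Data.List using (List; length; _++_)
open import Data.Product using (Σ; _×_; ∃; _,_; proj₁)
open import Relation.Binary.PropositionalEquality using (_≡_)
open import Data.Sum using (_⊎_)

_⊑_ : List ℕ → List ℕ → Set
ν ⊑ μ = Σ (List ℕ) λ ρ → ν ++ ρ ≡ μ

Comparable : List ℕ → List ℕ → Set
Comparable ν μ = ν ⊑ μ ⊎ μ ⊑ ν

IsTree : (List ℕ → Set) → Set
IsTree T = ∀ ν μ → ν ⊑ μ → T μ → T ν

StrictlyIncreasing : (ℕ → ℕ) → Set
StrictlyIncreasing y = ∀ a b → a < b → y a < y b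

Positive : (ℕ → ℕ) → Set
Positive y = ∀ a → NonZero (y a)

record BoundSystem (y : ℕ → ℕ) (n : ℕ) : Set where
  field
    k : ℕ
    j : Fin (suc k) → ℕ
    m : Fin (suc k) → ℕ
    j0 : j fzero > y (n + m fzero + 1)
    jstep : ∀ (l : Fin k) → j (fsuc l) > y (j (inject₁ l) + m (fsuc l) + 1)

Eta : ∀ {y n} → BoundSystem y n → Set
Eta S = (l : Fin (suc k)) → Fin (suc (m l)) → Σ (List ℕ) (λ η → length η ≡ j l)
  where open BoundSystem S

Squeezed : ∀ {y n} → (S : BoundSystem y n) → Eta S → (List ℕ → Set) → Set
Squeezed S η T =
  ∀ ν → T ν → Σ (Fin (suc k)) λ l → Σ (Fin (suc (m l))) λ t → Comparable ν (proj₁ (η l t))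
  where open BoundSystem S

YSqueezed : (ℕ → ℕ) → (List ℕ → Set) → Set
YSqueezed y T = ∀ n → Σ (BoundSystem y n) λ S → Σ (Eta S) λ η → Squeezed S η T

_∪_ : (List ℕ → Set) → (List ℕ → Set) → (List ℕ → Set)
(T ∪ T′) ν = T ν ⊎ T′ ν

module Submission where

-- A bound system S above n together with its labelling η is called
-- a pattern above n; its entries are the sequences η(l,t).  Being squeezed by a
-- pattern only depends on its set of entries, so it is inherited by any pattern
-- with more entries.  The key construction is concatenation: if P is a pattern
-- above n whose last level is j(k), and Q is a pattern above j(k), then the
-- levels of P followed by the levels of Q form a pattern above n (the bound
-- condition at the junction is exactly the condition "Q is above j(k)"), and
-- its entries include those of P and those of Q.  It is built by prepending the
-- levels of P one at a time.
--   For the theorem, given n take a pattern P above n squeezing T and a pattern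
-- Q above the last level of P squeezing T′; their concatenation squeezes both
-- T and T′, hence T ∪ T′.

open import Defs
open import Data.Nat using (ℕ; suc; _+_; _>_)
open import Data.Fin using (Fin; fromℕ; inject₁) renaming (suc to fsuc; zero to fzero)
open import Data.Vec.Functional using (_∷_)
open import Data.List using (List; length)
open import Data.Product using (_×_; Σ; _,_; proj₁; proj₂)
open import Data.Sum using (inj₁; inj₂; [_,_])
open import Relation.Binary.PropositionalEquality using (_≡_; refl; subst; sym)

private
  variable
    y : ℕ → ℕ
    n : ℕ

Pattern : (ℕ → ℕ) → ℕ → Set
Pattern y n = Σ (BoundSystem y n) Eta

Entry : Pattern y n → List ℕ → Set
Entry (S , η) ν = Σ (Fin (suc k)) λ l → Σ (Fin (suc (m l))) λ t → proj₁ (η l t) ≡ ν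
  where open BoundSystem S

SqueezedBy : Pattern y n → (List ℕ → Set) → Set
SqueezedBy (S , η) T = Squeezed S η T

-- The last level j(k) of a bound system; the next system must lie above it.
lastLevel : BoundSystem y n → ℕ
lastLevel S = j (fromℕ k) where open BoundSystem S

squeezed-mono : ∀ {n′} (P : Pattern y n) (Q : Pattern y n′) →
  (∀ {ν} → Entry P ν → Entry Q ν) → ∀ {T} → SqueezedBy P T → SqueezedBy Q T
squeezed-mono P Q P⊆Q sq ν ν∈T with sq ν ν∈T
... | l , t , c with P⊆Q (l , t , refl)
...   | l′ , t′ , e = l′ , t′ , subst (Comparable ν) (sym e) c

Row : ℕ → ℕ → Set
Row j₀ m₀ = Fin (suc m₀) → Σ (List ℕ) λ η → length η ≡ j₀

prepend : ∀ {j₀ m₀} → j₀ > y (n + m₀ + 1) → Row j₀ m₀ → Pattern y j₀ → Pattern y n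
prepend {y} {n} {j₀} {m₀} j₀-bound row (S , η) = S⁺ , η⁺
  where
  open BoundSystem S
  jstep⁺ : ∀ l → (j₀ ∷ j) (fsuc l) > y ((j₀ ∷ j) (inject₁ l) + (m₀ ∷ m) (fsuc l) + 1)
  jstep⁺ fzero    = j0
  jstep⁺ (fsuc l) = jstep l
  S⁺ : BoundSystem y n
  S⁺ = record { k = suc k ; j = j₀ ∷ j ; m = m₀ ∷ m ; j0 = j₀-bound ; jstep = jstep⁺ }
  η⁺ : Eta S⁺
  η⁺ fzero    = row
  η⁺ (fsuc l) = η l

prepend-row : ∀ {j₀ m₀} (b : j₀ > y (n + m₀ + 1)) (row : Row j₀ m₀) (P : Pattern y j₀) →
  ∀ t → Entry (prepend b row P) (proj₁ (row t))
prepend-row b row P t = fzero , t , refl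

prepend-old : ∀ {j₀ m₀} (b : j₀ > y (n + m₀ + 1)) (row : Row j₀ m₀) (P : Pattern y j₀) →
  ∀ {ν} → Entry P ν → Entry (prepend b row P) ν
prepend-old b row P (l , t , e) = fsuc l , t , e

record Concatenation (P : Pattern y n) (Q : Pattern y (lastLevel (proj₁ P))) : Set where
  field
    joined : Pattern y n
    left   : ∀ {ν} → Entry P ν → Entry joined ν
    right  : ∀ {ν} → Entry Q ν → Entry joined ν

-- Bound systems given by their fields, so that concatenation can recurse on k.
system : (k : ℕ) (j m : Fin (suc k) → ℕ) → j fzero > y (n + m fzero + 1) →
  (∀ l → j (fsuc l) > y (j (inject₁ l) + m (fsuc l) + 1)) → BoundSystem y n
system {y} {n} k j m j0 jstep = record { k = k ; j = j ; m = m ; j0 = j0 ; jstep = jstep }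

concatenate-levels : (k : ℕ) (j m : Fin (suc k) → ℕ) (j0 : j fzero > y (n + m fzero + 1))
  (jstep : ∀ l → j (fsuc l) > y (j (inject₁ l) + m (fsuc l) + 1))
  (η : Eta (system {y} {n} k j m j0 jstep)) (Q : Pattern y (j (fromℕ k))) →
  Concatenation (system {y} {n} k j m j0 jstep , η) Q
concatenate-levels 0 j m j0 jstep η Q = record
  { joined = prepend j0 (η fzero) Q
  ; left   = λ { (fzero , t , refl) → prepend-row j0 (η fzero) Q t }
  ; right  = prepend-old j0 (η fzero) Q
  }
concatenate-levels (suc k) j m j0 jstep η Q = record
  { joined = prepend j0 (η fzero) joined
  ; left   = λ { (fzero , t , refl) → prepend-row j0 (η fzero) joined t
               ; (fsuc l , t , e)   → prepend-old j0 (η fzero) joined (left (l , t , e)) }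
  ; right  = λ q → prepend-old j0 (η fzero) joined (right q)
  }
  where
  -- The levels after the first one form a pattern above j(0).
  open Concatenation (concatenate-levels k (λ l → j (fsuc l)) (λ l → m (fsuc l))
                        (jstep fzero) (λ l → jstep (fsuc l)) (λ l → η (fsuc l)) Q)

concatenate : (P : Pattern y n) (Q : Pattern y (lastLevel (proj₁ P))) → Concatenation P Q
concatenate (S , η) = concatenate-levels k j m j0 jstep η where open BoundSystem S

lemma7p10 : (y : ℕ → ℕ) → Positive y → StrictlyIncreasing y →
    (T T′ : List ℕ → Set) → IsTree T → IsTree T′ →
    YSqueezed y T → YSqueezed y T′ →
    IsTree (T ∪ T′) × YSqueezed y (T ∪ T′)
lemma7p10 y _ _ T T′ tree-T tree-T′ sq-T sq-T′ = tree , squeezed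
  where
  tree : IsTree (T ∪ T′)
  tree ν μ ν⊑μ = [ (λ μ∈T → inj₁ (tree-T ν μ ν⊑μ μ∈T)) , (λ μ∈T′ → inj₂ (tree-T′ ν μ ν⊑μ μ∈T′)) ]

  squeezed : YSqueezed y (T ∪ T′)
  squeezed n with sq-T n
  ... | S , η , S-sq with sq-T′ (lastLevel S)
  ...   | S′ , η′ , S′-sq = proj₁ R , proj₂ R , λ ν → [ sq-P ν , sq-Q ν ]
    where
    P : Pattern y n
    P = S , η
    Q : Pattern y (lastLevel S)
    Q = S′ , η′
    open Concatenation (concatenate P Q) renaming (joined to R)
    sq-P : SqueezedBy R T
    sq-P = squeezed-mono P R left S-sq
    sq-Q : SqueezedBy R T′
    sq-Q = squeezed-mono Q R right S′-sq
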